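{- If $G$ is a graph on $n \ge 6$ vertices and $\overline{G}$ is its complement, then $8 \le b_{\rm g}'(G)\, b_{\rm g}'(\overline{G}) \le 3n-6$.
   Context: The burning game on a finite simple graph $G$ (not necessarily connected) is played by two players, Burner and Staller. Each vertex is either burned or unburned, and once burned it stays burned. In round 1 the starting player chooses one unburned vertex and burns it (selection phase only). Each round $t \ge 2$ consists of a spreading phase, in which every unburned vertex with a burned neighbor becomes burned, followed, if unburned vertices remain, by a selection phase in which the player whose turn it is burns one unburned vertex; the two players make the selections alternately. The game ends in the first round in which all vertices are burned (this may happen right after a spreading phase), and its length is the number of that round. Burner wants to minimize the length and Staller to maximize it. $b_{\rm g}'(G)$ is the length under optimal play when Staller makes the first selection. -}

module Defs where

open import Data.Nat using (ℕ; zero; suc; _+_; _⊔_; _⊓_)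
open import Data.Bool using (Bool; true; false; _∧_; _∨_; not; if_then_else_)
open import Data.Fin using (Fin; _≟_)
open import Data.List using (List; []; _∷_; map; filterᵇ; foldr)
open import Data.Bool.ListAction using (any; all)
open import Data.Fin.Base using ()
open import Data.List using (allFin)
open import Relation.Binary.PropositionalEquality using (_≡_)
open import Relation.Nullary.Decidable using (⌊_⌋)

record Graph (n : ℕ) : Set where
  field
    adj    : Fin n → Fin n → Bool
    adj-sym    : ∀ u v → adj u v ≡ adj v u
    adj-irrefl : ∀ v → adj v v ≡ false
open Graph public

complement : ∀ {n} → Graph n → Graph n
complement {n} G = record
  { adj = λ u v → not (adj G u v) ∧ not ⌊ u ≟ v ⌋
  ; adj-sym = symC
  ; adj-irrefl = irrC }
  where
  open import Relation.Binary.PropositionalEquality using (refl; sym; cong₂)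
  open import Relation.Nullary using (yes; no)
  neq : ∀ (u v : Fin n) → ⌊ u ≟ v ⌋ ≡ ⌊ v ≟ u ⌋
  neq u v with u ≟ v | v ≟ u
  ... | yes _ | yes _ = refl
  ... | no _  | no _  = refl
  ... | yes p | no q = Data.Empty.⊥-elim (q (sym p)) where import Data.Empty
  ... | no p  | yes q = Data.Empty.⊥-elim (p (sym q)) where import Data.Empty
  symC : ∀ u v → (not (adj G u v) ∧ not ⌊ u ≟ v ⌋) ≡ (not (adj G v u) ∧ not ⌊ v ≟ u ⌋)
  symC u v = cong₂ (λ a b → not a ∧ not b) (adj-sym G u v) (neq u v)
  irrC : ∀ v → (not (adj G v v) ∧ not ⌊ v ≟ v ⌋) ≡ false
  irrC v with v ≟ v
  ... | yes _ = Data.Bool.Properties.∧-zeroʳ (not (adj G v v)) where import Data.Bool.Properties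
  ... | no ¬p = Data.Empty.⊥-elim (¬p refl) where import Data.Empty

Burned : ℕ → Set
Burned n = Fin n → Bool

data Player : Set where
  burner staller : Player

other : Player → Player
other burner  = staller
other staller = burner

allBurned : ∀ {n} → Burned n → Bool
allBurned {n} S = all S (allFin n)

unburnedList : ∀ {n} → Burned n → List (Fin n)
unburnedList {n} S = filterᵇ (λ v → not (S v)) (allFin n)

spread : ∀ {n} → Graph n → Burned n → Burned n
spread {n} G S v = S v ∨ any (λ u → adj G u v ∧ S u) (allFin n)

burn : ∀ {n} → Burned n → Fin n → Burned n
burn S v w = S w ∨ ⌊ v ≟ w ⌋

maxL : List ℕ → ℕ
maxL = foldr _⊔_ 0

-- minimum of a nonempty list (value on [] irrelevant)
minL : List ℕ → ℕ
minL []           = 0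
minL (x ∷ [])     = x
minL (x ∷ y ∷ xs) = x ⊓ minL (y ∷ xs)

opt : Player → List ℕ → ℕ
opt burner  = minL
opt staller = maxL

-- rest fuel G p S : number of further rounds under optimal play, given that
-- S is the burned set at the end of the current round and p makes the next
-- selection. The fuel only guarantees termination; each round burns at least
-- one new vertex, so fuel n (≥ number of unburned vertices) is sufficient.
rest : ∀ {n} → ℕ → Graph n → Player → Burned n → ℕ
rest zero     G p S = 0
rest (suc k)  G p S =
  if allBurned S then 0
  else (if allBurned (spread G S) then 1
        else suc (opt p (map (λ v → rest k G (other p) (burn (spread G S) v))
                               (unburnedList (spread G S)))))

gameLength : ∀ {n} → Graph n → Player → ℕ
gameLength {n} G p =
  opt p (map (λ v → suc (rest n G (other p) (burn (λ _ → false) v))) (allFin n))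

bg′ : ∀ {n} → Graph n → ℕ
bg′ G = gameLength G staller

{-# OPTIONS --safe #-}
module Submission where

-- Always 2 ≤ bg′ ≤ n.  If G has maximum degree at most one, closed neighbourhoods
-- have at most two vertices and are closed under spreading, so after Staller's opening, Burner's
-- reply and the next spread at most four vertices are burned; Staller's next selection leaves a
-- sixth vertex unburned, so bg′ G ≥ 4, while bg′ Ḡ ≤ 2 because every opening leaves at most one
-- vertex of Ḡ unburned.  Otherwise G and Ḡ both have a vertex c with two neighbours u, w.  Opening
-- at c in the other graph leaves u and w unburned, so both values are at least 3; and Burner burns
-- c (or, if c is already burned, a vertex the next spread misses), so the next spread burns four
-- vertices and bg′ ≤ n − 2.  Finally, either every vertex of G is within distance two of every
-- other, so bg′ G ≤ 3, or two vertices at distance at least three dominate Ḡ once Burner has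
-- burned the one Staller's opening missed, so bg′ Ḡ ≤ 3.

open import Defs
open import Data.Bool using (true; false; T; not; _∧_)
open import Data.Bool.Properties using (T-≡; T-not-≡; T-∧; T-∨; T?)
open import Data.Empty using (⊥-elim)
open import Data.Fin using (Fin; zero; suc; _≟_)
open import Data.Fin.Properties using (any?; all?; ¬∀⟶∃¬; pigeonhole)
import Data.Fin.Properties as Fin
open import Data.Fin.Subset
  using (Subset; ∣_∣; ⁅_⁆; _∪_)
  renaming (_∈_ to _∈ˢ_; _∉_ to _∉ˢ_; _⊆_ to _⊆ˢ_; _⊂_ to _⊂ˢ_)
open import Data.Fin.Subset.Properties
  using (∣p∣≤n; p⊆q⇒∣p∣≤∣q∣; p⊂q⇒∣p∣<∣q∣; x∈p∪q⁺; x∈p∪q⁻; p⊆p∪q; x∈⁅x⁆; x∈⁅y⁆⇒x≡y)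
open import Data.List using (List; []; _∷_; length; map; allFin; _++_; lookup)
open import Data.List.Membership.Propositional using (_∈_; _∉_; lose)
open import Data.List.Membership.Propositional.Properties using (∈-allFin; ∈-filter⁺; ∈-filter⁻; ∈-++⁺ˡ; ∈-++⁺ʳ)
open import Data.List.Relation.Unary.All as All using (All; []; _∷_)
open import Data.List.Relation.Unary.All.Properties using (all⁺; all⁻)
open import Data.List.Relation.Unary.Any using (here; there; index; satisfied)
open import Data.List.Relation.Unary.Any.Properties using (any⁺; any⁻; lookup-index)
open import Data.List.Relation.Unary.AllPairs using ([]; _∷_)
open import Data.List.Relation.Unary.Unique.Propositional using (Unique)
open import Data.Nat using (ℕ; zero; suc; _+_; _*_; _∸_; _≤_; _<_; z≤n; s≤s)
open import Data.Nat.Properties hiding (_≟_)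
open import Data.Product using (_×_; _,_; ∃-syntax; proj₁; proj₂)
open import Data.Sum using (_⊎_; inj₁; inj₂; map₂)
open import Data.Vec using (tabulate)
open import Data.Vec.Properties using (lookup∘tabulate; []=⇒lookup; lookup⇒[]=)
open import Function using (_∘_; Equivalence)
open import Relation.Binary.PropositionalEquality
open import Relation.Nullary using (¬_; Dec; yes; no; contradiction)
open import Relation.Nullary.Decidable using (toWitness; fromWitness; decidable-stable; _×-dec_; ¬?)

T-not⁺ : ∀ {b} → ¬ T b → T (not b)
T-not⁺ {false} _ = _
T-not⁺ {true} ¬t = ¬t _

T-not⁻ : ∀ {b} → T (not b) → ¬ T b
T-not⁻ {false} _ ()

¬T⇒≡false : ∀ {b} → ¬ T b → b ≡ false
¬T⇒≡false = Equivalence.to T-not-≡ ∘ T-not⁺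

module _ {A : Set} (f : A → ℕ) where

  ≤maxL : ∀ {x xs} → x ∈ xs → f x ≤ maxL (map f xs)
  ≤maxL {xs = y ∷ _} (here refl) = m≤m⊔n (f y) _
  ≤maxL {xs = y ∷ _} (there x∈xs) = ≤-trans (≤maxL x∈xs) (m≤n⊔m (f y) _)

  maxL≤ : ∀ {m} xs → (∀ {x} → x ∈ xs → f x ≤ m) → maxL (map f xs) ≤ m
  maxL≤ [] _ = z≤n
  maxL≤ (y ∷ ys) bound = ⊔-lub (bound (here refl)) (maxL≤ ys (bound ∘ there))

  minL≤ : ∀ {x xs} → x ∈ xs → minL (map f xs) ≤ f x
  minL≤ {xs = y ∷ []} (here refl) = ≤-refl
  minL≤ {xs = y ∷ _ ∷ _} (here refl) = m⊓n≤m (f y) _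
  minL≤ {xs = y ∷ _ ∷ _} (there x∈xs) = ≤-trans (m⊓n≤n (f y) _) (minL≤ x∈xs)

  ≤minL : ∀ {m x xs} → x ∈ xs → (∀ {x} → x ∈ xs → m ≤ f x) → m ≤ minL (map f xs)
  ≤minL {xs = y ∷ []} _ bound = bound (here refl)
  ≤minL {xs = y ∷ _ ∷ _} _ bound = ⊓-glb (bound (here refl)) (≤minL (here refl) (bound ∘ there))

  ≤opt : ∀ p {m x xs} → x ∈ xs → (∀ {x} → x ∈ xs → m ≤ f x) → m ≤ opt p (map f xs)
  ≤opt burner x∈xs bound = ≤minL x∈xs bound
  ≤opt staller x∈xs bound = ≤-trans (bound x∈xs) (≤maxL x∈xs)

  opt< : ∀ p {c x xs} → x ∈ xs → (∀ {x} → x ∈ xs → f x < c) → opt p (map f xs) < c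
  opt< p {zero} x∈xs bound = contradiction (bound x∈xs) λ ()
  opt< burner {suc c} x∈xs bound = s≤s (≤-trans (minL≤ x∈xs) (≤-pred (bound x∈xs)))
  opt< staller {suc c} {xs = xs} _ bound = s≤s (maxL≤ xs (≤-pred ∘ bound))

short-list-misses : ∀ {n} (xs : List (Fin n)) → length xs < n → ∃[ y ] y ∉ xs
short-list-misses {n} xs |xs|<n = ¬∀⟶∃¬ n (_∈ xs) (_∈? xs) λ covers →
  let i , j , i<j , same = pigeonhole |xs|<n (λ y → index (covers y))
  in Fin.<-irrefl (trans (lookup-index (covers i))
                    (trans (cong (lookup xs) same) (sym (lookup-index (covers j))))) i<j
  where open import Data.List.Membership.DecPropositional (_≟_ {n}) using (_∈?_)

length+∣p∣≤n : ∀ {n} {p : Subset n} {xs} → Unique xs → All (_∉ˢ p) xs → length xs + ∣ p ∣ ≤ n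
length+∣p∣≤n {p = p} {[]} _ _ = ∣p∣≤n p
length+∣p∣≤n {p = p} {x ∷ xs} (x≢xs ∷ unique) (x∉p ∷ xs∉p) = begin
  suc (length xs + ∣ p ∣)   ≡⟨ sym (+-suc (length xs) ∣ p ∣) ⟩
  length xs + suc ∣ p ∣     ≤⟨ +-monoʳ-≤ (length xs) (p⊂q⇒∣p∣<∣q∣ p⊂p∪x) ⟩
  length xs + ∣ p ∪ ⁅ x ⁆ ∣ ≤⟨ length+∣p∣≤n unique (All.zipWith outside (x≢xs , xs∉p)) ⟩
  _                         ∎
  where
  open ≤-Reasoning
  p⊂p∪x : p ⊂ˢ p ∪ ⁅ x ⁆
  p⊂p∪x = p⊆p∪q ⁅ x ⁆ , x , x∈p∪q⁺ (inj₂ (x∈⁅x⁆ x)) , x∉p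
  outside : ∀ {y} → x ≢ y × y ∉ˢ p → y ∉ˢ p ∪ ⁅ x ⁆
  outside (x≢y , y∉p) y∈ with x∈p∪q⁻ p ⁅ x ⁆ y∈
  ... | inj₁ y∈p = y∉p y∈p
  ... | inj₂ y∈x = x≢y (sym (x∈⁅y⁆⇒x≡y x y∈x))

module _ {n : ℕ} where

  private variable
    S S′ : Burned n
    v w x y : Fin n
    xs : List (Fin n)

  noneBurned : Burned n
  noneBurned _ = false

  firstBurn : Fin n → Burned n
  firstBurn = burn noneBurned

  infix 4 _⊑_
  _⊑_ : Burned n → Burned n → Set
  S ⊑ S′ = ∀ {x} → T (S x) → T (S′ x)

  AllBurned : Burned n → Set
  AllBurned S = ∀ y → T (S y)

  SomeUnburned : Burned n → Set
  SomeUnburned S = ∃[ y ] ¬ T (S y)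

  CoveredBy : Burned n → List (Fin n) → Set
  CoveredBy S xs = ∀ {y} → T (S y) → y ∈ xs

  allBurned⊎someUnburned : (S : Burned n) → AllBurned S ⊎ SomeUnburned S
  allBurned⊎someUnburned S with all? (T? ∘ S)
  ... | yes burned = inj₁ burned
  ... | no ¬burned = inj₂ (¬∀⟶∃¬ n (T ∘ S) (T? ∘ S) ¬burned)

  covered⇒someUnburned : CoveredBy S xs → length xs < n → SomeUnburned S
  covered⇒someUnburned {xs = xs} cover short =
    let y , y∉xs = short-list-misses xs short in y , y∉xs ∘ cover

  allBurned≡true : AllBurned S → allBurned S ≡ true
  allBurned≡true {S = S} burned =
    Equivalence.to T-≡ (all⁻ S {xs = allFin n} (All.tabulate λ {y} _ → burned y))

  allBurned≡false : ∀ (S : Burned n) {y} → ¬ T (S y) → allBurned S ≡ false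
  allBurned≡false S {y} ¬y =
    ¬T⇒≡false λ burned → ¬y (All.lookup (all⁺ S (allFin n) burned) (∈-allFin y))

  ∈-unburnedList⁺ : ∀ (S : Burned n) {x} → ¬ T (S x) → x ∈ unburnedList S
  ∈-unburnedList⁺ S {x} ¬x = ∈-filter⁺ (T? ∘ (not ∘ S)) (∈-allFin x) (T-not⁺ ¬x)

  ∈-unburnedList⁻ : ∀ (S : Burned n) {x} → x ∈ unburnedList S → ¬ T (S x)
  ∈-unburnedList⁻ S x∈ = T-not⁻ (proj₂ (∈-filter⁻ (T? ∘ (not ∘ S)) {xs = allFin n} x∈))

  unburned : Burned n → Subset n
  unburned S = tabulate (not ∘ S)

  ∈-unburned⁺ : ∀ (S : Burned n) {x} → ¬ T (S x) → x ∈ˢ unburned S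
  ∈-unburned⁺ S {x} ¬x =
    lookup⇒[]= x (unburned S) (trans (lookup∘tabulate (not ∘ S) x) (Equivalence.to T-≡ (T-not⁺ ¬x)))

  ∈-unburned⁻ : ∀ (S : Burned n) {x} → x ∈ˢ unburned S → ¬ T (S x)
  ∈-unburned⁻ S {x} x∈ =
    T-not⁻ (Equivalence.from T-≡ (trans (sym (lookup∘tabulate (not ∘ S) x)) ([]=⇒lookup x∈)))

  unburned-⊇ : S ⊑ S′ → unburned S′ ⊆ˢ unburned S
  unburned-⊇ {S = S} {S′ = S′} S⊑S′ x∈ = ∈-unburned⁺ S (∈-unburned⁻ S′ x∈ ∘ S⊑S′)

  ∣unburned∣-anti : S ⊑ S′ → ∣ unburned S′ ∣ ≤ ∣ unburned S ∣
  ∣unburned∣-anti = p⊆q⇒∣p∣≤∣q∣ ∘ unburned-⊇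

  ∣unburned∣-strict : ∀ x → S ⊑ S′ → ¬ T (S x) → T (S′ x) → ∣ unburned S′ ∣ < ∣ unburned S ∣
  ∣unburned∣-strict {S = S} {S′ = S′} x S⊑S′ ¬x x∈S′ =
    p⊂q⇒∣p∣<∣q∣ (unburned-⊇ S⊑S′ , x , ∈-unburned⁺ S ¬x , λ x∈ → ∈-unburned⁻ S′ x∈ x∈S′)

  ∣unburned∣-pos : ¬ T (S y) → 1 ≤ ∣ unburned S ∣
  ∣unburned∣-pos {y = y} ¬y = ≤-trans (s≤s z≤n) (∣unburned∣-strict {S′ = λ _ → true} y (λ _ → _) ¬y _)

  burn-new : ∀ (S : Burned n) v → T (burn S v v)
  burn-new S v = Equivalence.from (T-∨ {S v}) (inj₂ (fromWitness refl))

  burn-⊒ : ∀ S v → S ⊑ burn S v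
  burn-⊒ _ _ = Equivalence.from T-∨ ∘ inj₁

  burn⁻ : ∀ (S : Burned n) v {w} → T (burn S v w) → T (S w) ⊎ v ≡ w
  burn⁻ S v {w} = map₂ toWitness ∘ Equivalence.to (T-∨ {S w})

  burn-unburned : ¬ T (S w) → v ≢ w → ¬ T (burn S v w)
  burn-unburned {S = S} {v = v} ¬w v≢w t with burn⁻ S v t
  ... | inj₁ w∈ = ¬w w∈
  ... | inj₂ v≡w = v≢w v≡w

  burn-covered : ∀ v → CoveredBy S xs → CoveredBy (burn S v) (v ∷ xs)
  burn-covered {S = S} v cover t with burn⁻ S v t
  ... | inj₁ y∈ = there (cover y∈)
  ... | inj₂ v≡y = here (sym v≡y)

  firstBurn⁻ : ∀ v {w} → T (firstBurn v w) → v ≡ w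
  firstBurn⁻ v t with burn⁻ noneBurned v t
  ... | inj₁ ()
  ... | inj₂ v≡w = v≡w

  burned≢unburned : T (S x) → ¬ T (S y) → x ≢ y
  burned≢unburned x∈ ¬y refl = ¬y x∈

module _ {n : ℕ} (G : Graph n) where

  private variable
    S S′ : Burned n
    v y z : Fin n

  closedNbhd : Fin n → Burned n
  closedNbhd v = spread G (firstBurn v)

  Dominates : Burned n → Set
  Dominates S = AllBurned (spread G S)

  spread-⊒ : ∀ S → S ⊑ spread G S
  spread-⊒ _ = Equivalence.from T-∨ ∘ inj₁

  spread-adj : ∀ S → T (S z) → T (adj G z y) → T (spread G S y)
  spread-adj {z = z} {y = y} S z∈S z~y = Equivalence.from (T-∨ {S y})
    (inj₂ (any⁺ (λ u → adj G u y ∧ S u) (lose (∈-allFin z) (Equivalence.from T-∧ (z~y , z∈S)))))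

  spread⁻ : T (spread G S y) → T (S y) ⊎ ∃[ z ] T (S z) × T (adj G z y)
  spread⁻ {S = S} {y = y} y∈ with Equivalence.to (T-∨ {S y}) y∈
  ... | inj₁ y∈S = inj₁ y∈S
  ... | inj₂ nbr with satisfied (any⁻ (λ u → adj G u y ∧ S u) (allFin n) nbr)
  ...   | z , z~y∧z∈S = let z~y , z∈S = Equivalence.to T-∧ z~y∧z∈S in inj₂ (z , z∈S , z~y)

  spread-mono : S ⊑ S′ → spread G S ⊑ spread G S′
  spread-mono {S′ = S′} S⊑S′ y∈ with spread⁻ y∈
  ... | inj₁ y∈S = spread-⊒ S′ (S⊑S′ y∈S)
  ... | inj₂ (z , z∈S , z~y) = spread-adj S′ (S⊑S′ z∈S) z~y

  Dominates-mono : S ⊑ S′ → Dominates S → Dominates S′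
  Dominates-mono S⊑S′ dom y = spread-mono S⊑S′ (dom y)

  closedNbhd-self : ∀ v → T (closedNbhd v v)
  closedNbhd-self v = spread-⊒ (firstBurn v) (burn-new noneBurned v)

  closedNbhd-adj : T (adj G v y) → T (closedNbhd v y)
  closedNbhd-adj {v = v} = spread-adj (firstBurn v) (burn-new noneBurned v)

  closedNbhd⁻ : ∀ v {y} → T (closedNbhd v y) → v ≡ y ⊎ T (adj G v y)
  closedNbhd⁻ v y∈ with spread⁻ y∈
  ... | inj₁ y∈S = inj₁ (firstBurn⁻ v y∈S)
  ... | inj₂ (z , z∈S , z~y) with firstBurn⁻ v z∈S
  ...   | refl = inj₂ z~y

  ∉closedNbhd⁺ : v ≢ y → ¬ T (adj G v y) → ¬ T (closedNbhd v y)
  ∉closedNbhd⁺ {v = v} v≢y ¬v~y y∈ with closedNbhd⁻ v y∈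
  ... | inj₁ v≡y = v≢y v≡y
  ... | inj₂ v~y = ¬v~y v~y

  ∉closedNbhd⁻ : ¬ T (closedNbhd v y) → v ≢ y × ¬ T (adj G v y)
  ∉closedNbhd⁻ {v = v} ¬y = (λ { refl → ¬y (closedNbhd-self v) }) , ¬y ∘ closedNbhd-adj

  spread-burn⁻ : ∀ S x → T (spread G (burn S x) y) → T (spread G S y) ⊎ T (closedNbhd x y)
  spread-burn⁻ S x y∈ with spread⁻ y∈
  ... | inj₁ y∈B with burn⁻ S x y∈B
  ...   | inj₁ y∈S = inj₁ (spread-⊒ S y∈S)
  ...   | inj₂ refl = inj₂ (closedNbhd-self x)
  spread-burn⁻ S x y∈ | inj₂ (z , z∈B , z~y) with burn⁻ S x z∈B
  ...   | inj₁ z∈S = inj₁ (spread-adj S z∈S z~y)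
  ...   | inj₂ refl = inj₂ (closedNbhd-adj z~y)

  restAfter : ℕ → Player → Burned n → Fin n → ℕ
  restAfter k p S x = rest k G (other p) (burn (spread G S) x)

  rest-done : ∀ k p → AllBurned S → rest k G p S ≡ 0
  rest-done zero _ _ = refl
  rest-done (suc k) _ burned rewrite allBurned≡true burned = refl

  rest-last : ∀ k p → ¬ T (S y) → Dominates S → rest (suc k) G p S ≡ 1
  rest-last {S = S} _ _ ¬y dom rewrite allBurned≡false S ¬y | allBurned≡true dom = refl

  rest-move : ∀ k p → ¬ T (spread G S y) →
              rest (suc k) G p S ≡ suc (opt p (map (restAfter k p S) (unburnedList (spread G S))))
  rest-move {S = S} _ _ ¬y
    rewrite allBurned≡false S (¬y ∘ spread-⊒ S) | allBurned≡false (spread G S) ¬y = refl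

  rest≥1 : ∀ k p S → SomeUnburned S → 1 ≤ rest (suc k) G p S
  rest≥1 k p S (y , ¬y) with allBurned⊎someUnburned (spread G S)
  ... | inj₁ dom = ≤-reflexive (sym (rest-last k p ¬y dom))
  ... | inj₂ (z , ¬z) = subst (1 ≤_) (sym (rest-move k p ¬z)) (s≤s z≤n)

  rest≥-allReplies : ∀ k p S {m} → SomeUnburned (spread G S) →
                     (∀ {x} → ¬ T (spread G S x) → m ≤ restAfter k p S x) →
                     suc m ≤ rest (suc k) G p S
  rest≥-allReplies k p S (y , ¬y) bound rewrite rest-move k p ¬y =
    s≤s (≤opt (restAfter k p S) p (∈-unburnedList⁺ (spread G S) ¬y) (bound ∘ ∈-unburnedList⁻ (spread G S)))

  rest≥-stallerReply : ∀ k S x {m} → ¬ T (spread G S x) → m ≤ restAfter k staller S x →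
                       suc m ≤ rest (suc k) G staller S
  rest≥-stallerReply k S x ¬x bound rewrite rest-move k staller ¬x =
    s≤s (≤-trans bound (≤maxL (restAfter k staller S) (∈-unburnedList⁺ (spread G S) ¬x)))

  rest≥2-covered : ∀ k S xs → CoveredBy (spread G S) xs → 2 + length xs ≤ n →
                   2 ≤ rest (suc (suc k)) G staller S
  rest≥2-covered k S xs cover long =
    let z , ¬z = covered⇒someUnburned cover (≤-trans (n≤1+n _) long)
    in rest≥-stallerReply (suc k) S z ¬z
         (rest≥1 k burner (burn (spread G S) z) (covered⇒someUnburned (burn-covered z cover) long))

  rest≤-burnerReply : ∀ k S x {m} → ¬ T (spread G S x) → restAfter k burner S x ≤ m →
                      rest (suc k) G burner S ≤ suc m
  rest≤-burnerReply k S x ¬x bound rewrite rest-move k burner ¬x =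
    s≤s (≤-trans (minL≤ (restAfter k burner S) (∈-unburnedList⁺ (spread G S) ¬x)) bound)

  rest≤1 : ∀ k p S → Dominates S → rest k G p S ≤ 1
  rest≤1 zero _ _ _ = z≤n
  rest≤1 (suc k) p S dom with allBurned⊎someUnburned S
  ... | inj₁ burned = subst (_≤ 1) (sym (rest-done (suc k) p burned)) z≤n
  ... | inj₂ (y , ¬y) = ≤-reflexive (rest-last k p ¬y dom)

  mutual
    rest≤∣unburned∣ : ∀ k p S → rest k G p S ≤ ∣ unburned S ∣
    rest≤∣unburned∣ k p S with allBurned⊎someUnburned S
    ... | inj₁ burned = subst (_≤ _) (sym (rest-done k p burned)) z≤n
    ... | inj₂ (y , ¬y) = rest≤ k p S (∣unburned∣-pos {S = S} ¬y) (∣unburned∣-anti {S′ = spread G S} (spread-⊒ S))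

    rest≤ : ∀ k p S {m} → 1 ≤ m → ∣ unburned (spread G S) ∣ ≤ m → rest k G p S ≤ m
    rest≤ zero _ _ _ _ = z≤n
    rest≤ (suc k) p S 1≤m bound with allBurned⊎someUnburned (spread G S)
    ... | inj₁ dom = ≤-trans (rest≤1 (suc k) p S dom) 1≤m
    ... | inj₂ (y , ¬y) = ≤-trans (subst (_≤ _) (sym (rest-move k p ¬y)) opt<∣unburned∣) bound
      where
      N : Burned n
      N = spread G S
      each : ∀ {x} → x ∈ unburnedList N → restAfter k p S x < ∣ unburned N ∣
      each {x} x∈ = ≤-<-trans (rest≤∣unburned∣ k (other p) (burn N x))
                      (∣unburned∣-strict x (burn-⊒ N x) (∈-unburnedList⁻ N x∈) (burn-new N x))
      opt<∣unburned∣ : suc (opt p (map (restAfter k p S) (unburnedList N))) ≤ ∣ unburned N ∣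
      opt<∣unburned∣ = opt< (restAfter k p S) p (∈-unburnedList⁺ N ¬y) each

  bg′≥ : ∀ v → suc (rest n G burner (firstBurn v)) ≤ bg′ G
  bg′≥ v = ≤maxL (λ v → suc (rest n G burner (firstBurn v))) (∈-allFin v)

  bg′≤ : ∀ {b} → (∀ v → suc (rest n G burner (firstBurn v)) ≤ b) → bg′ G ≤ b
  bg′≤ bound = maxL≤ (λ v → suc (rest n G burner (firstBurn v))) (allFin n) (λ {v} _ → bound v)

module _ {n : ℕ} (G : Graph n) where

  private variable
    u v y : Fin n

  adj-symᵀ : T (adj G u v) → T (adj G v u)
  adj-symᵀ {u = u} {v = v} = subst T (adj-sym G u v)

  adj⇒≢ : T (adj G u v) → u ≢ v
  adj⇒≢ {u = u} u~u refl = subst T (adj-irrefl G u) u~u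

  HasDegree≥2 : Set
  HasDegree≥2 = ∃[ c ] ∃[ u ] ∃[ w ] T (adj G c u) × T (adj G c w) × u ≢ w

  MaxDegree≤1 : Set
  MaxDegree≤1 = ∀ {c u w} → T (adj G c u) → T (adj G c w) → u ≡ w

  maxDegree≤1⊎hasDegree≥2 : MaxDegree≤1 ⊎ HasDegree≥2
  maxDegree≤1⊎hasDegree≥2
    with any? (λ c → any? λ u → any? λ w → T? (adj G c u) ×-dec T? (adj G c w) ×-dec ¬? (u ≟ w))
  ... | yes (c , u , w , cherry) = inj₂ (c , u , w , cherry)
  ... | no ¬cherry = inj₁ λ {c} {u} {w} c~u c~w →
    decidable-stable (u ≟ w) λ u≢w → ¬cherry (c , u , w , c~u , c~w , u≢w)

  closedNbhd-covered : MaxDegree≤1 → ∀ v → ∃[ u ] CoveredBy (closedNbhd G v) (v ∷ u ∷ [])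
  closedNbhd-covered Δ≤1 v with any? (λ u → T? (adj G v u))
  ... | yes (u , v~u) = u , covered
    where
    covered : CoveredBy (closedNbhd G v) (v ∷ u ∷ [])
    covered y∈ with closedNbhd⁻ G v y∈
    ... | inj₁ v≡y = here (sym v≡y)
    ... | inj₂ v~y = there (here (Δ≤1 v~y v~u))
  ... | no isolated = v , covered
    where
    covered : CoveredBy (closedNbhd G v) (v ∷ v ∷ [])
    covered y∈ with closedNbhd⁻ G v y∈
    ... | inj₁ v≡y = here (sym v≡y)
    ... | inj₂ v~y = ⊥-elim (isolated (_ , v~y))

  closedNbhd-closed : MaxDegree≤1 → ∀ v → spread G (closedNbhd G v) ⊑ closedNbhd G v
  closedNbhd-closed Δ≤1 v y∈ with spread⁻ G y∈
  ... | inj₁ y∈N = y∈N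
  ... | inj₂ (z , z∈N , z~y) with closedNbhd⁻ G v z∈N
  ...   | inj₁ refl = closedNbhd-adj G z~y
  ...   | inj₂ v~z = subst (T ∘ closedNbhd G v) (Δ≤1 (adj-symᵀ v~z) z~y) (closedNbhd-self G v)

  Diameter≤2 : Set
  Diameter≤2 = ∀ v → Dominates G (closedNbhd G v)

  Distance≥3 : Fin n → Fin n → Set
  Distance≥3 v x = ¬ T (spread G (closedNbhd G v) x)

  eccentricity≤2? : ∀ v → Dec (Dominates G (closedNbhd G v))
  eccentricity≤2? v = all? (T? ∘ spread G (closedNbhd G v))

  diameter≤2⊎distance≥3 : Diameter≤2 ⊎ ∃[ v ] ∃[ x ] Distance≥3 v x
  diameter≤2⊎distance≥3 with all? eccentricity≤2?
  ... | yes diam≤2 = inj₁ diam≤2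
  ... | no ¬diam≤2 =
    let v , ¬ecc≤2 = ¬∀⟶∃¬ n _ eccentricity≤2? ¬diam≤2
        x , far = ¬∀⟶∃¬ n _ (T? ∘ spread G (closedNbhd G v)) ¬ecc≤2
    in inj₂ (v , x , far)

  private
    Gᶜ : Graph n
    Gᶜ = complement G

  adjᶜ⁺ : ¬ T (adj G u v) → u ≢ v → T (adj Gᶜ u v)
  adjᶜ⁺ ¬u~v u≢v = Equivalence.from T-∧ (T-not⁺ ¬u~v , T-not⁺ (u≢v ∘ toWitness))

  adjᶜ⁻ : T (adj Gᶜ u v) → ¬ T (adj G u v) × u ≢ v
  adjᶜ⁻ {u = u} {v = v} u~ᶜv =
    let ¬u~v , u≢v = Equivalence.to (T-∧ {not (adj G u v)}) u~ᶜv in T-not⁻ ¬u~v , T-not⁻ u≢v ∘ fromWitness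

  ¬adjᶜ : ¬ T (adj Gᶜ u v) → u ≢ v → T (adj G u v)
  ¬adjᶜ {u = u} {v = v} ¬u~ᶜv u≢v = decidable-stable (T? (adj G u v)) λ ¬u~v → ¬u~ᶜv (adjᶜ⁺ ¬u~v u≢v)

  ∉closedNbhd⇒adjᶜ : ¬ T (closedNbhd G v y) → T (adj Gᶜ v y)
  ∉closedNbhd⇒adjᶜ y∉N = let v≢y , ¬v~y = ∉closedNbhd⁻ G y∉N in adjᶜ⁺ ¬v~y v≢y

  adjᶜ⇒∉closedNbhd : T (adj Gᶜ v y) → ¬ T (closedNbhd G v y)
  adjᶜ⇒∉closedNbhd v~ᶜy = let ¬v~y , v≢y = adjᶜ⁻ v~ᶜy in ∉closedNbhd⁺ G v≢y ¬v~y

module _ {n : ℕ} (G : Graph n) where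

  private
    variable
      u v : Fin n
    Gᶜ : Graph n
    Gᶜ = complement G

  adjᶜᶜ⁺ : T (adj G u v) → T (adj (complement Gᶜ) u v)
  adjᶜᶜ⁺ u~v = adjᶜ⁺ Gᶜ (λ u~ᶜv → proj₁ (adjᶜ⁻ G u~ᶜv) u~v) (adj⇒≢ G u~v)

  adjᶜᶜ⁻ : T (adj (complement Gᶜ) u v) → T (adj G u v)
  adjᶜᶜ⁻ u~ᶜᶜv = let ¬u~ᶜv , u≢v = adjᶜ⁻ Gᶜ u~ᶜᶜv in ¬adjᶜ G ¬u~ᶜv u≢v

  HasDegree≥2-complement² : HasDegree≥2 G → HasDegree≥2 (complement Gᶜ)
  HasDegree≥2-complement² (c , u , w , c~u , c~w , u≢w) = c , u , w , adjᶜᶜ⁺ c~u , adjᶜᶜ⁺ c~w , u≢w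

  MaxDegree≤1-complement² : MaxDegree≤1 G → MaxDegree≤1 (complement Gᶜ)
  MaxDegree≤1-complement² Δ≤1 c~u c~w = Δ≤1 (adjᶜᶜ⁻ c~u) (adjᶜᶜ⁻ c~w)

-- Having no common neighbour, v and x together dominate the complement.
module _ {n : ℕ} (G : Graph n) {v x : Fin n} (far : Distance≥3 G v x) where

  private
    Gᶜ : Graph n
    Gᶜ = complement G

  x∉N[v] : ¬ T (closedNbhd G v x)
  x∉N[v] = far ∘ spread-⊒ G (closedNbhd G v)

  noCommonNeighbour : ∀ {y} → T (adj G v y) → ¬ T (adj G y x)
  noCommonNeighbour v~y y~x = far (spread-adj G (closedNbhd G v) (closedNbhd-adj G v~y) y~x)

  farPair-dominatesᶜ : ∀ B → T (B v) → T (B x) → Dominates Gᶜ B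
  farPair-dominatesᶜ B v∈B x∈B y with T? (closedNbhd G v y)
  ... | no y∉N = spread-adj Gᶜ B v∈B (∉closedNbhd⇒adjᶜ G y∉N)
  ... | yes y∈N with closedNbhd⁻ G v y∈N
  ...   | inj₁ refl = spread-⊒ Gᶜ B v∈B
  ...   | inj₂ v~y = spread-adj Gᶜ B x∈B (adjᶜ⁺ G (noCommonNeighbour v~y ∘ adj-symᵀ G) x≢y)
    where
    x≢y : x ≢ y
    x≢y refl = x∉N[v] y∈N

  closedNbhdᶜ-meets-farPair : ∀ u → T (closedNbhd Gᶜ u v) ⊎ T (closedNbhd Gᶜ u x)
  closedNbhdᶜ-meets-farPair u with T? (closedNbhd Gᶜ u v)
  ... | yes v∈ = inj₁ v∈
  ... | no v∉ = inj₂ (closedNbhd-adj Gᶜ (adjᶜ⁺ G (noCommonNeighbour v~u) u≢x))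
    where
    v~u : T (adj G v u)
    v~u = let u≢v , ¬u~ᶜv = ∉closedNbhd⁻ Gᶜ v∉ in adj-symᵀ G (¬adjᶜ G ¬u~ᶜv u≢v)
    u≢x : u ≢ x
    u≢x refl = x∉N[v] (closedNbhd-adj G v~u)

  farPair-replyᶜ : ∀ u → ∃[ w ] Dominates Gᶜ (burn (closedNbhd Gᶜ u) w)
  farPair-replyᶜ u with closedNbhdᶜ-meets-farPair u
  ... | inj₁ v∈ = x , farPair-dominatesᶜ (burn N x) (burn-⊒ N x v∈) (burn-new N x)
    where N = closedNbhd Gᶜ u
  ... | inj₂ x∈ = v , farPair-dominatesᶜ (burn N v) (burn-new N v) (burn-⊒ N v x∈)
    where N = closedNbhd Gᶜ u

BurnerReply : ∀ {n} (G : Graph (suc n)) → Fin (suc n) → ℕ → Set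
BurnerReply {n} G v m = ∃[ x ] ¬ T (closedNbhd G v x) × rest n G staller (burn (closedNbhd G v) x) ≤ m

bg′≥-opening : ∀ {n} (G : Graph (suc n)) v {m} → SomeUnburned (closedNbhd G v) →
               (∀ {x} → ¬ T (closedNbhd G v x) → m ≤ rest n G staller (burn (closedNbhd G v) x)) →
               2 + m ≤ bg′ G
bg′≥-opening {n} G v unburned bound =
  ≤-trans (s≤s (rest≥-allReplies G n burner (firstBurn v) unburned bound)) (bg′≥ G v)

bg′≤-reply : ∀ {n} (G : Graph (suc n)) {m} →
             (∀ v → SomeUnburned (closedNbhd G v) → BurnerReply G v m) → bg′ G ≤ 2 + m
bg′≤-reply {n} G {m} reply = bg′≤ G λ v → s≤s (burnerAnswers v)
  where
  burnerAnswers : ∀ v → rest (suc n) G burner (firstBurn v) ≤ suc m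
  burnerAnswers v with allBurned⊎someUnburned (closedNbhd G v)
  ... | inj₁ dom = ≤-trans (rest≤1 G (suc n) burner (firstBurn v) dom) (s≤s z≤n)
  ... | inj₂ unburned =
    let x , ¬x , bound = reply v unburned in rest≤-burnerReply G n (firstBurn v) x ¬x bound

bg′≥2 : ∀ {n} (G : Graph n) → 2 ≤ n → 2 ≤ bg′ G
bg′≥2 G (s≤s (s≤s (z≤n {n}))) =
  ≤-trans (s≤s (rest≥1 G (suc n) burner (firstBurn zero) (suc zero , λ ()))) (bg′≥ G zero)

bg′≥3 : ∀ {n} (G : Graph n) → 2 ≤ n → HasDegree≥2 (complement G) → 3 ≤ bg′ G
bg′≥3 G (s≤s (s≤s (z≤n {n}))) (c , u , w , c≁u , c≁w , u≢w) =
  bg′≥-opening G c (u , u∉N) λ {x} _ → rest≥1 G n staller (burn N x) (oneSurvives x)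
  where
  N : Burned (2 + n)
  N = closedNbhd G c
  u∉N : ¬ T (N u)
  u∉N = adjᶜ⇒∉closedNbhd G c≁u
  w∉N : ¬ T (N w)
  w∉N = adjᶜ⇒∉closedNbhd G c≁w
  oneSurvives : ∀ x → SomeUnburned (burn N x)
  oneSurvives x with x ≟ u
  ... | yes refl = w , burn-unburned {S = N} w∉N u≢w
  ... | no x≢u = u , burn-unburned {S = N} u∉N x≢u

-- N[v] is closed under spreading, so after Burner's reply x only the at most four vertices of
-- N[v] ∪ N[x] are burned, and Staller's next selection still leaves a vertex unburned.
bg′≥4 : ∀ {n} (G : Graph n) → 6 ≤ n → MaxDegree≤1 G → 4 ≤ bg′ G
bg′≥4 G 6≤n@(s≤s (s≤s (s≤s (s≤s (s≤s (s≤s (z≤n {n}))))))) Δ≤1 =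
  stallerOpens zero (closedNbhd-covered G Δ≤1 zero)
  where
  stallerOpens : ∀ v → ∃[ u ] CoveredBy (closedNbhd G v) (v ∷ u ∷ []) → 4 ≤ bg′ G
  stallerOpens v (u , N[v]⊆) =
    bg′≥-opening G v (covered⇒someUnburned N[v]⊆ (≤-trans (s≤s (s≤s (s≤s z≤n))) 6≤n))
      λ {x} _ → twoMoreRounds x (closedNbhd-covered G Δ≤1 x)
    where
    twoMoreRounds : ∀ x → ∃[ u′ ] CoveredBy (closedNbhd G x) (x ∷ u′ ∷ []) →
                    2 ≤ rest (5 + n) G staller (burn (closedNbhd G v) x)
    twoMoreRounds x (u′ , N[x]⊆) = rest≥2-covered G (3 + n) (burn (closedNbhd G v) x) _ X⊆ 6≤n
      where
      X⊆ : CoveredBy (spread G (burn (closedNbhd G v) x)) ((x ∷ u′ ∷ []) ++ (v ∷ u ∷ []))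
      X⊆ y∈ with spread-burn⁻ G (closedNbhd G v) x y∈
      ... | inj₁ y∈spreadN = ∈-++⁺ʳ (x ∷ u′ ∷ []) (N[v]⊆ (closedNbhd-closed G Δ≤1 v y∈spreadN))
      ... | inj₂ y∈N[x] = ∈-++⁺ˡ (N[x]⊆ y∈N[x])

bg′≤n : ∀ {n} (G : Graph n) → bg′ G ≤ n
bg′≤n {n} G = bg′≤ G λ v → ≤-trans (s≤s (rest≤∣unburned∣ G n burner (firstBurn v)))
  (≤-trans (∣unburned∣-strict {S = noneBurned} {S′ = firstBurn v} v (λ ()) (λ ()) (burn-new noneBurned v))
           (∣p∣≤n (unburned noneBurned)))

bg′≤2 : ∀ {n} (G : Graph n) → MaxDegree≤1 (complement G) → bg′ G ≤ 2
bg′≤2 {zero} G _ = z≤n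
bg′≤2 {suc n} G Δᶜ≤1 =
  bg′≤-reply G λ v (y , ¬y) → y , ¬y , ≤-reflexive (rest-done G n staller (burnsAll v ¬y))
  where
  burnsAll : ∀ v {y} → ¬ T (closedNbhd G v y) → AllBurned (burn (closedNbhd G v) y)
  burnsAll v {y} ¬y z with T? (closedNbhd G v z)
  ... | yes z∈N = burn-⊒ (closedNbhd G v) y z∈N
  ... | no ¬z = subst (T ∘ burn (closedNbhd G v) y)
                  (Δᶜ≤1 (∉closedNbhd⇒adjᶜ G {v} {y} ¬y) (∉closedNbhd⇒adjᶜ G {v} {z} ¬z))
                  (burn-new (closedNbhd G v) y)

bg′≤3 : ∀ {n} (G : Graph n) → (∀ u → ∃[ w ] Dominates G (burn (closedNbhd G u) w)) → bg′ G ≤ 3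
bg′≤3 {zero} G _ = z≤n
bg′≤3 {suc n} G dominatingReply = bg′≤-reply G answer
  where
  answer : ∀ v → SomeUnburned (closedNbhd G v) → BurnerReply G v 1
  answer v (y , ¬y) with dominatingReply v
  ... | w , dom with T? (closedNbhd G v w)
  ...   | no ¬w = w , ¬w , rest≤1 G n staller _ dom
  ...   | yes w∈N = y , ¬y , rest≤1 G n staller _ (Dominates-mono G absorb dom)
    where
    absorb : burn (closedNbhd G v) w ⊑ burn (closedNbhd G v) y
    absorb z∈ with burn⁻ (closedNbhd G v) w z∈
    ... | inj₁ z∈N = burn-⊒ (closedNbhd G v) y z∈N
    ... | inj₂ refl = burn-⊒ (closedNbhd G v) y w∈N

diameter≤2⇒bg′≤3 : ∀ {n} (G : Graph n) → Diameter≤2 G → bg′ G ≤ 3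
diameter≤2⇒bg′≤3 G diam≤2 = bg′≤3 G λ u → u , Dominates-mono G (burn-⊒ (closedNbhd G u) u) (diam≤2 u)

distance≥3⇒bg′ᶜ≤3 : ∀ {n} (G : Graph n) {v x} → Distance≥3 G v x → bg′ (complement G) ≤ 3
distance≥3⇒bg′ᶜ≤3 G far = bg′≤3 (complement G) (farPair-replyᶜ G far)

-- Burner replies so that c, u, w and a fourth vertex are burned after the next spread.
bg′≤n∸2 : ∀ {n} (G : Graph n) → 5 ≤ n → HasDegree≥2 G → bg′ G ≤ n ∸ 2
bg′≤n∸2 G (s≤s (s≤s (s≤s (s≤s (s≤s (z≤n {m})))))) (c , u , w , c~u , c~w , u≢w) =
  bg′≤-reply G λ v unburned → answer v unburned (T? (closedNbhd G v c))
  where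
  cherry⇒rest≤ : ∀ k p B {a} → T (B a) → T (B c) → a ≢ c → a ≢ u → a ≢ w → rest k G p B ≤ suc m
  cherry⇒rest≤ k p B {a} a∈B c∈B a≢c a≢u a≢w =
    rest≤ G k p B (s≤s z≤n) (+-cancelˡ-≤ 4 _ _ (length+∣p∣≤n distinct (All.map burned⇒∉unburned burned)))
    where
    X = spread G B
    distinct : Unique (a ∷ c ∷ u ∷ w ∷ [])
    distinct = (a≢c ∷ a≢u ∷ a≢w ∷ []) ∷ (adj⇒≢ G c~u ∷ adj⇒≢ G c~w ∷ []) ∷ (u≢w ∷ []) ∷ [] ∷ []
    burned : All (T ∘ X) (a ∷ c ∷ u ∷ w ∷ [])
    burned = spread-⊒ G B a∈B ∷ spread-⊒ G B c∈B ∷ spread-adj G B c∈B c~u ∷ spread-adj G B c∈B c~w ∷ []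
    burned⇒∉unburned : ∀ {y} → T (X y) → y ∉ˢ unburned X
    burned⇒∉unburned y∈X y∈ˢ = ∈-unburned⁻ X y∈ˢ y∈X
  answerAfterSpread : ∀ v → SomeUnburned (closedNbhd G v) → T (closedNbhd G v c) →
                      Dominates G (closedNbhd G v) ⊎ SomeUnburned (spread G (closedNbhd G v)) →
                      BurnerReply G v (suc m)
  answerAfterSpread v (y , ¬y) _ (inj₁ dom) =
    y , ¬y , ≤-trans (rest≤1 G (4 + m) staller (burn (closedNbhd G v) y)
                        (Dominates-mono G (burn-⊒ (closedNbhd G v) y) dom)) (s≤s z≤n)
  answerAfterSpread v _ c∈N (inj₂ (z , ¬z)) =
    z , ¬z ∘ spread-⊒ G N , cherry⇒rest≤ (4 + m) staller (burn N z) (burn-new N z) (burn-⊒ N z c∈N) z≢c z≢u z≢w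
    where
    N = closedNbhd G v
    z≢c = ≢-sym (burned≢unburned (spread-⊒ G N c∈N) ¬z)
    z≢u = ≢-sym (burned≢unburned (spread-adj G N c∈N c~u) ¬z)
    z≢w = ≢-sym (burned≢unburned (spread-adj G N c∈N c~w) ¬z)
  answer : ∀ v → SomeUnburned (closedNbhd G v) → Dec (T (closedNbhd G v c)) → BurnerReply G v (suc m)
  answer v _ (no c∉N) = c , c∉N , cherry⇒rest≤ (4 + m) staller (burn N c)
                                    (burn-⊒ N c (closedNbhd-self G v)) (burn-new N c) v≢c v≢u v≢w
    where
    N = closedNbhd G v
    v≢c = burned≢unburned (closedNbhd-self G v) c∉N
    v≢u : v ≢ u
    v≢u refl = c∉N (closedNbhd-adj G (adj-symᵀ G c~u))
    v≢w : v ≢ w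
    v≢w refl = c∉N (closedNbhd-adj G (adj-symᵀ G c~w))
  answer v unburned (yes c∈N) =
    answerAfterSpread v unburned c∈N (allBurned⊎someUnburned (spread G (closedNbhd G v)))

2n≤3n∸6 : ∀ {n} → 6 ≤ n → 2 * n ≤ 3 * n ∸ 6
2n≤3n∸6 {n} 6≤n = m+n≤o⇒m≤o∸n (2 * n) (begin
  2 * n + 6 ≤⟨ +-monoʳ-≤ (2 * n) 6≤n ⟩
  2 * n + n ≡⟨ +-comm (2 * n) n ⟩
  3 * n     ∎)
  where open ≤-Reasoning

bg′*bg′ᶜ≥8 : ∀ {n} (G : Graph n) → 6 ≤ n → 8 ≤ bg′ G * bg′ (complement G)
bg′*bg′ᶜ≥8 G 6≤n = byDegrees (maxDegree≤1⊎hasDegree≥2 G) (maxDegree≤1⊎hasDegree≥2 (complement G))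
  where
  2≤n = ≤-trans (s≤s (s≤s z≤n)) 6≤n
  byDegrees : MaxDegree≤1 G ⊎ HasDegree≥2 G → MaxDegree≤1 (complement G) ⊎ HasDegree≥2 (complement G) →
              8 ≤ bg′ G * bg′ (complement G)
  byDegrees (inj₁ Δ≤1) _ = *-mono-≤ (bg′≥4 G 6≤n Δ≤1) (bg′≥2 (complement G) 2≤n)
  byDegrees (inj₂ _) (inj₁ Δᶜ≤1) = *-mono-≤ (bg′≥2 G 2≤n) (bg′≥4 (complement G) 6≤n Δᶜ≤1)
  byDegrees (inj₂ deg) (inj₂ degᶜ) = ≤-trans (n≤1+n 8)
    (*-mono-≤ (bg′≥3 G 2≤n degᶜ) (bg′≥3 (complement G) 2≤n (HasDegree≥2-complement² G deg)))

bg′*bg′ᶜ≤3n∸6 : ∀ {n} (G : Graph n) → 6 ≤ n → bg′ G * bg′ (complement G) ≤ 3 * n ∸ 6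
bg′*bg′ᶜ≤3n∸6 {n} G 6≤n = byDegrees (maxDegree≤1⊎hasDegree≥2 G) (maxDegree≤1⊎hasDegree≥2 (complement G))
  where
  5≤n = ≤-trans (n≤1+n 5) 6≤n
  3[n∸2]≡3n∸6 : 3 * (n ∸ 2) ≡ 3 * n ∸ 6
  3[n∸2]≡3n∸6 = *-distribˡ-∸ 3 n 2
  byDegrees : MaxDegree≤1 G ⊎ HasDegree≥2 G → MaxDegree≤1 (complement G) ⊎ HasDegree≥2 (complement G) →
              bg′ G * bg′ (complement G) ≤ 3 * n ∸ 6
  byDegrees (inj₁ Δ≤1) _ =
    ≤-trans (*-mono-≤ (bg′≤n G) (bg′≤2 (complement G) (MaxDegree≤1-complement² G Δ≤1)))
            (≤-trans (≤-reflexive (*-comm n 2)) (2n≤3n∸6 6≤n))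
  byDegrees (inj₂ _) (inj₁ Δᶜ≤1) =
    ≤-trans (*-mono-≤ (bg′≤2 G Δᶜ≤1) (bg′≤n (complement G))) (2n≤3n∸6 6≤n)
  byDegrees (inj₂ deg) (inj₂ degᶜ) with diameter≤2⊎distance≥3 G
  ... | inj₁ diam≤2 =
    ≤-trans (*-mono-≤ (diameter≤2⇒bg′≤3 G diam≤2) (bg′≤n∸2 (complement G) 5≤n degᶜ))
            (≤-reflexive 3[n∸2]≡3n∸6)
  ... | inj₂ (_ , _ , far) =
    ≤-trans (*-mono-≤ (bg′≤n∸2 G 5≤n deg) (distance≥3⇒bg′ᶜ≤3 G far))
            (≤-reflexive (trans (*-comm (n ∸ 2) 3) 3[n∸2]≡3n∸6))

proposition3p8 : (n : ℕ) → 6 ≤ n → (G : Graph n) →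
    (8 ≤ bg′ G * bg′ (complement G)) × (bg′ G * bg′ (complement G) ≤ 3 * n ∸ 6)
proposition3p8 n 6≤n G = bg′*bg′ᶜ≥8 G 6≤n , bg′*bg′ᶜ≤3n∸6 G 6≤n
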